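{- Let $G$ be a finite simple undirected graph with $\operatorname{girth}(G)\ge 2\chi(G)-1$. Then $G$ is sc-orientable.
   Context: $\chi(G)$ is the chromatic number of $G$; the girth is the length of a shortest cycle (infinite if $G$ is acyclic). A directed graph $D$ is singly connected if for every ordered pair of vertices $(s,t)$ there is at most one directed path from $s$ to $t$ in $D$. For an undirected graph $G$, an $E(G)$-orientation is a map $\sigma$ assigning to each edge one of its endpoints (its head), giving a directed graph $G_\sigma$; $\sigma$ is an sc-orientation if $G_\sigma$ is singly connected, and $G$ is sc-orientable if it has an sc-orientation. -}

module Defs where

open import Data.Nat using (ℕ; zero; suc; _≤_)
open import Data.Fin using (Fin; zero; suc; inject₁; fromℕ)
open import Data.Bool using (Bool; true; false)
open import Data.List using (List; []; _∷_)
open import Data.List.Relation.Unary.Unique.Propositional using (Unique)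
open import Data.Product using (Σ; _×_; _,_)
open import Data.Sum using (_⊎_)
open import Relation.Binary.PropositionalEquality using (_≡_; _≢_)
open import Function.Definitions using (Injective)

record Graph (n : ℕ) : Set where
  field
    adj   : Fin n → Fin n → Bool
    sym   : ∀ u v → adj u v ≡ adj v u
    irrfl : ∀ v → adj v v ≡ false

module _ {n : ℕ} (G : Graph n) where
  open Graph G

  Adj : Fin n → Fin n → Set
  Adj u v = adj u v ≡ true

  Colorable : ℕ → Set
  Colorable k = Σ (Fin n → Fin k) λ c → ∀ u v → Adj u v → c u ≢ c v

  IsChromaticNumber : ℕ → Set
  IsChromaticNumber k = Colorable k × (∀ j → Colorable j → k ≤ j)

  record Cycle (m : ℕ) : Set where
    field
      w      : Fin (suc m) → Fin n
      long   : 3 ≤ suc m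
      inj    : Injective _≡_ _≡_ w
      steps  : ∀ (i : Fin m) → Adj (w (inject₁ i)) (w (suc i))
      close  : Adj (w (fromℕ m)) (w zero)

  -- girth(G) ≥ g : every cycle has length ≥ g (vacuous if G is acyclic,
  -- matching girth = ∞)
  GirthAtLeast : ℕ → Set
  GirthAtLeast g = ∀ m → Cycle m → g ≤ suc m

  -- E(G)-orientation: σ assigns to each edge {u,v} one of its endpoints.
  -- Represented as a symmetric function on pairs (values on non-edges
  -- are irrelevant).
  record Orientation : Set where
    field
      σ       : Fin n → Fin n → Fin n
      σ-sym   : ∀ u v → Adj u v → σ u v ≡ σ v u
      σ-end   : ∀ u v → Adj u v → σ u v ≡ u ⊎ σ u v ≡ v

  Arc : Orientation → Fin n → Fin n → Set
  Arc o u v = Adj u v × Orientation.σ o u v ≡ v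

  data Walk (o : Orientation) : List (Fin n) → Fin n → Fin n → Set where
    single : ∀ s → Walk o (s ∷ []) s s
    step   : ∀ {s u t xs} → Arc o s u → Walk o (u ∷ xs) u t →
             Walk o (s ∷ u ∷ xs) s t

  DPath : Orientation → List (Fin n) → Fin n → Fin n → Set
  DPath o xs s t = Walk o xs s t × Unique xs

  SinglyConnected : Orientation → Set
  SinglyConnected o = ∀ s t xs ys → DPath o xs s t → DPath o ys s t → xs ≡ ys

  SCOrientable : Set
  SCOrientable = Σ Orientation SinglyConnected

-- Colour G properly with χ colours and orient every edge towards its endpoint of larger
-- colour. Colours strictly increase along directed paths, so every directed path has at
-- most χ vertices. If two directed s–t paths differed, then after their common initial
-- segment they would leave some vertex through different arcs and meet again later;
-- the two segments up to the first meeting vertex form a cycle with at most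
-- (χ - 1) + (χ - 1) < 2χ - 1 edges, contradicting the girth bound.
{-# OPTIONS --safe #-}
module Submission where

open import Defs
open import Data.Nat using (ℕ; suc; _+_; _*_; _∸_; _≤_; _<_; z≤n; s≤s; z<s)
open import Data.Nat.Properties
  using (≤-trans; ≤-reflexive; <⇒≱; ≮⇒≥; ≤-antisym; +-mono-≤; +-monoʳ-<;
         +-identityʳ; +-suc; +-monoʳ-≤; m≤m+n; m≤n+m; m<m+n; n<1+n; module ≤-Reasoning)
open import Data.Fin as Fin using (Fin; zero; suc; inject₁; fromℕ; toℕ; _≟_)
open import Data.Fin.Properties using (toℕ-injective; toℕ<n; _<?_; <-asym)
open import Data.List using (List; []; _∷_; _++_; _ʳ++_; [_]; length; lookup)
open import Data.List.Properties using (++-assoc; ++-ʳ++; length-ʳ++; length-++; length-map; ∷-injectiveˡ)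
open import Data.List.Membership.Propositional using (_∈_; _∉_; lose)
open import Data.List.Membership.Propositional.Properties using (∈-lookup; ∈-∃++; ∈-++⁺ˡ; ∈-++⁻)
import Data.List.Membership.DecPropositional as DecMembership
open import Data.List.Relation.Unary.All as All using (All)
open import Data.List.Relation.Unary.All.Properties using (All¬⇒¬Any; ++⁻ˡ)
open import Data.List.Relation.Unary.Any using (here; there)
open import Data.List.Relation.Unary.AllPairs using (_∷_)
open import Data.List.Relation.Unary.First as First using (first)
open import Data.List.Relation.Unary.First.Properties using (toView)
open import Data.List.Relation.Unary.Linked as Linked using (Linked; []; [-]; _∷_)
open import Data.List.Relation.Unary.Linked.Properties using (map⁺)
open import Data.List.Relation.Unary.Unique.Propositional using (Unique) renaming (tail to Unique-tail)
import Data.List.Relation.Unary.Unique.Propositional.Properties as Unique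
open import Data.List.Relation.Binary.Disjoint.Propositional using (Disjoint)
open import Data.List.Relation.Binary.Permutation.Propositional using (_↭_; ↭-sym; ↭⇒↭ₛ)
open import Data.List.Relation.Binary.Permutation.Propositional.Properties using (++↭ʳ++; ∷↭∷ʳ)
import Data.List.Relation.Binary.Permutation.Setoid.Properties as Permutationₛ
open import Data.Product using (∃; ∃₂; ∃-syntax; _×_; _,_; proj₁)
open import Data.Sum using (_⊎_; inj₁; inj₂)
import Data.Sum as Sum
open import Data.Empty using (⊥-elim)
open import Data.Bool using (true; false)
open import Function.Definitions using (Injective)
open import Relation.Binary using (Rel; Symmetric; DecidableEquality)
open import Relation.Binary.PropositionalEquality
  using (_≡_; _≢_; refl; sym; trans; cong; subst; setoid)
open import Relation.Nullary using (yes; no)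
import Relation.Nullary.Decidable as Dec

module _ {a} {A : Set a} where

  ʳ++-++ : ∀ (xs : List A) {ys zs} → xs ʳ++ (ys ++ zs) ≡ (xs ʳ++ ys) ++ zs
  ʳ++-++ []       = refl
  ʳ++-++ (x ∷ xs) = ʳ++-++ xs

  Unique-resp-↭ : ∀ {xs ys : List A} → xs ↭ ys → Unique xs → Unique ys
  Unique-resp-↭ p = Permutationₛ.Unique-resp-↭ (setoid A) (↭⇒↭ₛ p)

  Unique-++⁻ˡ : ∀ (xs : List A) {ys} → Unique (xs ++ ys) → Unique xs
  Unique-++⁻ˡ []       _          = Unique.[]
  Unique-++⁻ˡ (x ∷ xs) (x∉ ∷ u) = ++⁻ˡ xs x∉ ∷ Unique-++⁻ˡ xs u

  lookup-injective : ∀ {xs : List A} → Unique xs → Injective _≡_ _≡_ (lookup xs)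
  lookup-injective {x ∷ xs} _         {zero}  {zero}  _  = refl
  lookup-injective {x ∷ xs} (x∉ ∷ _) {zero}  {suc j} eq = ⊥-elim (All.lookup x∉ (∈-lookup j) eq)
  lookup-injective {x ∷ xs} (x∉ ∷ _) {suc i} {zero}  eq = ⊥-elim (All.lookup x∉ (∈-lookup i) (sym eq))
  lookup-injective {x ∷ xs} (_ ∷ u)  {suc i} {suc j} eq = cong suc (lookup-injective u eq)

  firstCommon : DecidableEquality A → ∀ {v} xs ys → v ∈ xs → v ∈ ys →
                ∃₂ λ xs₁ x → ∃ λ xs₂ → xs ≡ xs₁ ++ x ∷ xs₂ × All (_∉ ys) xs₁ × x ∈ ys
  firstCommon _≟_ xs ys v∈xs v∈ys
    with first (λ u → Sum.swap (Dec.toSum (u ∈? ys))) xs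
    where open DecMembership _≟_ using (_∈?_)
  ... | inj₂ none = ⊥-elim (All¬⇒¬Any none (lose v∈xs v∈ys))
  ... | inj₁ f with toView f
  ...   | First._++_∷_ before x∈ys after = _ , _ , after , refl , before , x∈ys

module _ {a ℓ} {A : Set a} {R : Rel A ℓ} where

  Linked-++⁻ˡ : ∀ xs {ys} → Linked R (xs ++ ys) → Linked R xs
  Linked-++⁻ˡ []           _       = []
  Linked-++⁻ˡ (x ∷ [])     _       = [-]
  Linked-++⁻ˡ (x ∷ y ∷ xs) (r ∷ l) = r ∷ Linked-++⁻ˡ (y ∷ xs) l

  Linked-ʳ++ : Symmetric R → ∀ {x} xs {ys} →
               Linked R (x ∷ xs) → Linked R (x ∷ ys) → Linked R (xs ʳ++ x ∷ ys)
  Linked-ʳ++ R-sym []       _       l = l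
  Linked-ʳ++ R-sym (y ∷ xs) (r ∷ l) m = Linked-ʳ++ R-sym xs l (R-sym r ∷ m)

  Linked⇒lookup-suc : ∀ {x z} xs → Linked R (x ∷ xs ++ [ z ]) → (i : Fin (length xs)) →
                      R (lookup (x ∷ xs) (inject₁ i)) (lookup (x ∷ xs) (suc i))
  Linked⇒lookup-suc (y ∷ ys) (r ∷ _) zero    = r
  Linked⇒lookup-suc (y ∷ ys) (_ ∷ l) (suc i) = Linked⇒lookup-suc ys l i

  Linked⇒lookup-last : ∀ {x z} xs → Linked R (x ∷ xs ++ [ z ]) →
                       R (lookup (x ∷ xs) (fromℕ (length xs))) z
  Linked⇒lookup-last []       (r ∷ _) = r
  Linked⇒lookup-last (y ∷ ys) (_ ∷ l) = Linked⇒lookup-last ys l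

increasing-length+head< : ∀ {k i} {is : List (Fin k)} → Linked Fin._<_ (i ∷ is) →
                          length is + toℕ i < k
increasing-length+head< {i = i} [-] = toℕ<n i
increasing-length+head< {i = i} {j ∷ js} (i<j ∷ l) = begin-strict
  suc (length js + toℕ i) ≡⟨ +-suc (length js) (toℕ i) ⟨
  length js + suc (toℕ i) ≤⟨ +-monoʳ-≤ (length js) i<j ⟩
  length js + toℕ j       <⟨ increasing-length+head< l ⟩
  _                       ∎
  where open ≤-Reasoning

strictlyIncreasing-length≤ : ∀ {k} {is : List (Fin k)} → Linked Fin._<_ is → length is ≤ k
strictlyIncreasing-length≤ {is = []}    _ = z≤n
strictlyIncreasing-length≤ {is = _ ∷ _} l = ≤-trans (s≤s (m≤m+n _ _)) (increasing-length+head< l)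

sum-of-predecessors< : ∀ {a b k} → suc a ≤ k → suc b ≤ k → a + b < 2 * k ∸ 1
sum-of-predecessors< {a} {b} {suc k} (s≤s a≤k) (s≤s b≤k) = begin-strict
  a + b          ≤⟨ +-mono-≤ a≤k b≤k ⟩
  k + k          <⟨ +-monoʳ-< k (n<1+n k) ⟩
  k + suc k      ≡⟨ cong (k +_) (+-identityʳ (suc k)) ⟨
  2 * suc k ∸ 1  ∎
  where open ≤-Reasoning

module _ {n} (G : Graph n) where

  Adj-sym : Symmetric (Adj G)
  Adj-sym {u} {v} e = trans (Graph.sym G v u) e

  closedPath⇒Cycle : ∀ {x} cs → Unique (x ∷ cs) → Linked (Adj G) (x ∷ cs ++ [ x ]) →
                     2 ≤ length cs → Cycle G (length cs)
  closedPath⇒Cycle {x} cs u l 2≤ = record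
    { w     = lookup (x ∷ cs)
    ; long  = s≤s 2≤
    ; inj   = lookup-injective u
    ; steps = Linked⇒lookup-suc cs l
    ; close = Linked⇒lookup-last cs l
    }

  internallyDisjointPaths⇒Cycle :
    ∀ {s x} p q →
    Linked (Adj G) (s ∷ p ++ [ x ]) → Unique (s ∷ p ++ [ x ]) →
    Linked (Adj G) (s ∷ q ++ [ x ]) → Unique (s ∷ q ++ [ x ]) →
    Disjoint p q → p ≢ q → Cycle G (length p + suc (length q))
  internallyDisjointPaths⇒Cycle {s} {x} p q Lp Up Lq Uq@(_ ∷ Uq+x) p#q p≢q =
    subst (Cycle G) (length-ʳ++ p) (closedPath⇒Cycle (p ʳ++ s ∷ q) unique closed
                     (subst (2 ≤_) (sym (length-ʳ++ p)) (twoEdges p q p≢q)))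
    where
    P = s ∷ p ++ [ x ]

    rotate : P ʳ++ q ≡ x ∷ p ʳ++ s ∷ q
    rotate = ++-ʳ++ (s ∷ p)

    -- The cycle goes back from x to s along p, then forward along q.
    closed : Linked (Adj G) (x ∷ (p ʳ++ s ∷ q) ++ [ x ])
    closed = subst (Linked (Adj G)) (trans (++-ʳ++ p) (cong (x ∷_) (ʳ++-++ p)))
                   (Linked-ʳ++ Adj-sym (p ++ [ x ]) Lp Lq)

    x∷q-unique : Unique (x ∷ q)
    x∷q-unique = Unique-resp-↭ (↭-sym (∷↭∷ʳ x q)) Uq+x

    P#q : Disjoint P q
    P#q (here refl , v∈q) = Unique.Unique[x∷xs]⇒x∉xs Uq (∈-++⁺ˡ v∈q)
    P#q (there v∈p+x , v∈q) with ∈-++⁻ p v∈p+x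
    ... | inj₁ v∈p        = p#q (v∈p , v∈q)
    ... | inj₂ (here refl) = Unique.Unique[x∷xs]⇒x∉xs x∷q-unique v∈q

    unique : Unique (x ∷ p ʳ++ s ∷ q)
    unique = subst Unique rotate
      (Unique-resp-↭ (++↭ʳ++ P q) (Unique.++⁺ Up (Unique-tail x∷q-unique) P#q))

    twoEdges : ∀ (ps qs : List (Fin n)) → ps ≢ qs → 2 ≤ length ps + suc (length qs)
    twoEdges []       []      ps≢qs = ⊥-elim (ps≢qs refl)
    twoEdges []       (_ ∷ _) _     = s≤s (s≤s z≤n)
    twoEdges (_ ∷ ps) qs      _     = s≤s (≤-trans (s≤s z≤n) (m≤n+m (suc (length qs)) (length ps)))

  divergingPaths⇒Cycle :
    ∀ {s a b t} p q → a ≢ b →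
    Linked (Adj G) (s ∷ a ∷ p) → Unique (s ∷ a ∷ p) → t ∈ a ∷ p →
    Linked (Adj G) (s ∷ b ∷ q) → Unique (s ∷ b ∷ q) → t ∈ b ∷ q →
    ∃[ m ] Cycle G m × suc m ≤ length (a ∷ p) + length (b ∷ q)
  divergingPaths⇒Cycle {s} {a} {b} p q a≢b Lp Up t∈p Lq Uq t∈q
    with firstCommon _≟_ (a ∷ p) (b ∷ q) t∈p t∈q
  ... | p₁ , x , p₂ , ap≡ , p₁∉bq , x∈bq with ∈-∃++ x∈bq
  ... | q₁ , q₂ , bq≡ =
    length p₁ + suc (length q₁) ,
    internallyDisjointPaths⇒Cycle p₁ q₁
      (toMeeting Linked-++⁻ˡ p₁ ap≡ Lp) (toMeeting Unique-++⁻ˡ p₁ ap≡ Up)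
      (toMeeting Linked-++⁻ˡ q₁ bq≡ Lq) (toMeeting Unique-++⁻ˡ q₁ bq≡ Uq)
      p₁#q₁ (distinctStarts p₁ q₁ ap≡ bq≡ p₁#q₁) ,
    +-mono-≤ (beforeMeeting p₁ ap≡) (beforeMeeting q₁ bq≡)
    where
    toMeeting : ∀ {ℓ} {Pr : List (Fin n) → Set ℓ} → (∀ xs {ys} → Pr (xs ++ ys) → Pr xs) →
                ∀ {r} r₁ {r₂} → r ≡ r₁ ++ x ∷ r₂ → Pr (s ∷ r) → Pr (s ∷ r₁ ++ [ x ])
    toMeeting {Pr = Pr} prefix r₁ {r₂} refl pr =
      prefix (s ∷ r₁ ++ [ x ]) (subst Pr (cong (s ∷_) (sym (++-assoc r₁ [ x ] r₂))) pr)

    beforeMeeting : ∀ {r} r₁ {r₂} → r ≡ r₁ ++ x ∷ r₂ → suc (length r₁) ≤ length r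
    beforeMeeting r₁ refl = ≤-trans (m<m+n (length r₁) z<s) (≤-reflexive (sym (length-++ r₁)))

    p₁#q₁ : Disjoint p₁ q₁
    p₁#q₁ (v∈p₁ , v∈q₁) = All.lookup p₁∉bq v∈p₁ (subst (_ ∈_) (sym bq≡) (∈-++⁺ˡ v∈q₁))

    distinctStarts : ∀ r₁ r₂ {r₁′ r₂′} → a ∷ p ≡ r₁ ++ x ∷ r₁′ → b ∷ q ≡ r₂ ++ x ∷ r₂′ →
                     Disjoint r₁ r₂ → r₁ ≢ r₂
    distinctStarts []      []      eqa eqb _   _ = a≢b (trans (∷-injectiveˡ eqa) (sym (∷-injectiveˡ eqb)))
    distinctStarts []      (_ ∷ _) _   _   _   ()
    distinctStarts (_ ∷ _) _       _   _   dis refl = dis (here refl , here refl)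

module _ {n} {G : Graph n} {o : Orientation G} where

  Walk⇒Linked : ∀ {xs s t} → Walk G o xs s t → Linked (Arc G o) xs
  Walk⇒Linked (single s)            = [-]
  Walk⇒Linked (step a (single _))   = a ∷ [-]
  Walk⇒Linked (step a w@(step _ _)) = a ∷ Walk⇒Linked w

  Walk⇒end∈ : ∀ {xs s t} → Walk G o xs s t → t ∈ xs
  Walk⇒end∈ (single s) = here refl
  Walk⇒end∈ (step _ w) = there (Walk⇒end∈ w)

  secondVertex-unique⇒SinglyConnected :
    (∀ {s t a b p q} → DPath G o (s ∷ a ∷ p) s t → DPath G o (s ∷ b ∷ q) s t → a ≡ b) →
    SinglyConnected G o
  secondVertex-unique⇒SinglyConnected same s t xs ys (w₁ , u₁) (w₂ , u₂) = equal w₁ u₁ w₂ u₂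
    where
    equal : ∀ {xs ys s t} → Walk G o xs s t → Unique xs → Walk G o ys s t → Unique ys → xs ≡ ys
    equal (single _)    _  (single _)    _  = refl
    equal (single _)    _  (step _ w)    u  = ⊥-elim (Unique.Unique[x∷xs]⇒x∉xs u (Walk⇒end∈ w))
    equal (step _ w)    u  (single _)    _  = ⊥-elim (Unique.Unique[x∷xs]⇒x∉xs u (Walk⇒end∈ w))
    equal {s = s} (step a₁ w₁) u₁ (step a₂ w₂) u₂ with same (step a₁ w₁ , u₁) (step a₂ w₂ , u₂)
    ... | refl = cong (s ∷_) (equal w₁ (Unique-tail u₁) w₂ (Unique-tail u₂))

module _ {n χ} (G : Graph n) (c : Fin n → Fin χ) (proper : ∀ u v → Adj G u v → c u ≢ c v) where

  towardsLargerColour : Fin n → Fin n → Fin n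
  towardsLargerColour u v with c u <? c v
  ... | yes _ = v
  ... | no  _ = u

  colourOrientation : Orientation G
  colourOrientation = record { σ = towardsLargerColour ; σ-sym = σ-sym ; σ-end = σ-end }
    where
    σ-sym : ∀ u v → Adj G u v → towardsLargerColour u v ≡ towardsLargerColour v u
    σ-sym u v uv with c u <? c v | c v <? c u
    ... | yes u<v | yes v<u = ⊥-elim (<-asym u<v v<u)
    ... | yes _   | no  _   = refl
    ... | no  _   | yes _   = refl
    ... | no  u≮v | no  v≮u = ⊥-elim (proper u v uv (toℕ-injective (≤-antisym (≮⇒≥ v≮u) (≮⇒≥ u≮v))))

    σ-end : ∀ u v → Adj G u v → towardsLargerColour u v ≡ u ⊎ towardsLargerColour u v ≡ v
    σ-end u v _ with c u <? c v
    ... | yes _ = inj₂ refl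
    ... | no  _ = inj₁ refl

  Arc⇒colour< : ∀ {u v} → Arc G colourOrientation u v → c u Fin.< c v
  Arc⇒colour< {u} {v} (uv , head≡v) with c u <? c v
  ... | yes u<v = u<v
  ... | no  _   = ⊥-elim (true≢false (trans (sym (subst (Adj G u) (sym head≡v) uv)) (Graph.irrfl G u)))
    where
    true≢false : true ≢ false
    true≢false ()

  Walk⇒length≤ : ∀ {xs s t} → Walk G colourOrientation xs s t → length xs ≤ χ
  Walk⇒length≤ {xs} w = subst (_≤ χ) (length-map c xs)
    (strictlyIncreasing-length≤ (map⁺ (Linked.map Arc⇒colour< (Walk⇒Linked w))))

  colourOrientation-secondVertex-unique :
    GirthAtLeast G (2 * χ ∸ 1) →
    ∀ {s t a b p q} → DPath G colourOrientation (s ∷ a ∷ p) s t →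
    DPath G colourOrientation (s ∷ b ∷ q) s t → a ≡ b
  colourOrientation-secondVertex-unique girth {a = a} {b} {p} {q} (w₁@(step _ w₁′) , u₁) (w₂@(step _ w₂′) , u₂)
    with a ≟ b
  ... | yes a≡b = a≡b
  ... | no  a≢b with divergingPaths⇒Cycle G p q a≢b
                       (Linked.map proj₁ (Walk⇒Linked w₁)) u₁ (Walk⇒end∈ w₁′)
                       (Linked.map proj₁ (Walk⇒Linked w₂)) u₂ (Walk⇒end∈ w₂′)
  ...   | m , cycle , short = ⊥-elim (<⇒≱ (sum-of-predecessors< (Walk⇒length≤ w₁) (Walk⇒length≤ w₂))
                                           (≤-trans (girth m cycle) short))

theorem5 : ∀ (n : ℕ) (G : Graph n) (χ : ℕ) →
             IsChromaticNumber G χ →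
             GirthAtLeast G (2 * χ ∸ 1) →
             SCOrientable G
theorem5 n G χ ((c , proper) , _) girth =
  colourOrientation G c proper ,
  secondVertex-unique⇒SinglyConnected (colourOrientation-secondVertex-unique G c proper girth)
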